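{- $conv\le_K\mathcal{S}_\omega$.
   Context: Equip $2^\omega$ with the Haar measure; $\Omega$ is the countable set of clopen subsets of $2^\omega$ of measure $\frac12$, $\Omega_n$ the set of clopen subsets of measure $\frac1{2^n}$. $\mathcal{S}^+_n=\{A\subseteq\Omega:(\forall V\in\Omega_n)(\exists U\in A)(U\cap V=\emptyset)\}$, $\mathcal{S}^+_\omega=\bigcup_n\mathcal{S}^+_n$, $\mathcal{S}_\omega=\mathcal{P}(\Omega)\setminus\mathcal{S}^+_\omega$ (an ideal on $\Omega$). $conv$ is the ideal on $\mathbb{Q}\cap[0,1]$ generated by the sequences of rationals in $[0,1]$ that converge in $[0,1]$. For ideals $\mathcal{I}$ on $X$ and $\mathcal{J}$ on $Y$, $\mathcal{I}\le_K\mathcal{J}$ means there is $f:Y\to X$ with $f^{ -1}[A]\in\mathcal{J}$ for every $A\in\mathcal{I}$. -}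

module Defs where

open import Level using (0ℓ)
open import Data.Bool using (Bool; true; false)
open import Data.Nat as ℕ using (ℕ; zero; suc; _^_)
open import Data.Nat.Properties using (m^n≢0)
open import Data.Fin using (Fin)
open import Data.Vec using (Vec; []; _∷_)
open import Data.Integer using (+_)
open import Data.Rational using (ℚ; _/_; _≤_; _-_; ∣_∣; 0ℚ; 1ℚ; _<_)
open import Data.Product using (Σ; ∃; ∃-syntax; _×_; proj₁)
open import Relation.Binary.PropositionalEquality using (_≡_)
open import Relation.Nullary using (¬_)
open import Relation.Unary using (Pred)

Cantor : Set
Cantor = ℕ → Bool

take : (n : ℕ) → Cantor → Vec Bool n
take zero    x = []
take (suc n) x = x 0 ∷ take n (λ i → x (suc i))

-- A clopen set is a finite union of basic cylinders: it is given by a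
-- level n and the set of length-n strings whose cylinders it contains.
record Clopen : Set where
  constructor clopen
  field
    level : ℕ
    chars : Vec Bool level → Bool
open Clopen public

_∈C_ : Cantor → Clopen → Set
x ∈C U = chars U (take (level U) x) ≡ true

_≈C_ : Clopen → Clopen → Set
U ≈C V = ∀ x → chars U (take (level U) x) ≡ chars V (take (level V) x)

Disjoint : Clopen → Clopen → Set
Disjoint U V = ∀ x → ¬ (x ∈C U × x ∈C V)

count : (n : ℕ) → (Vec Bool n → Bool) → ℕ
count zero    c with c []
... | true  = 1
... | false = 0
count (suc n) c = count n (λ v → c (false ∷ v)) ℕ.+ count n (λ v → c (true ∷ v))

μ : Clopen → ℚ
μ U = _/_ (+ count (level U) (chars U)) (2 ^ level U) {{m^n≢0 2 (level U)}}

half^ : ℕ → ℚ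
half^ n = _/_ (+ 1) (2 ^ n) {{m^n≢0 2 n}}

Ω : Set
Ω = Σ Clopen (λ U → μ U ≡ half^ 1)

Ωₙ : ℕ → Pred Clopen 0ℓ
Ωₙ n V = μ V ≡ half^ n

S⁺ : ℕ → Pred (Pred Ω 0ℓ) 0ℓ
S⁺ n A = ∀ (V : Clopen) → Ωₙ n V → ∃[ U ] (A U × Disjoint (proj₁ U) V)

S⁺ω : Pred (Pred Ω 0ℓ) 0ℓ
S⁺ω A = ∃[ n ] S⁺ n A

Sω : Pred (Pred Ω 0ℓ) 0ℓ
Sω A = ¬ S⁺ω A

Q01 : Set
Q01 = Σ ℚ (λ q → 0ℚ ≤ q × q ≤ 1ℚ)

-- a sequence in ℚ ∩ [0,1] converges in [0,1]  (⇔ Cauchy, [0,1] complete)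
Converges : (ℕ → Q01) → Set
Converges s = ∀ (ε : ℚ) → 0ℚ < ε → ∃[ N ] (∀ m n → N ℕ.≤ m → N ℕ.≤ n →
                ∣ proj₁ (s m) - proj₁ (s n) ∣ ≤ ε)

-- conv: the ideal generated by ranges of convergent sequences, i.e.
-- sets covered by finitely many such ranges
conv : Pred (Pred Q01 0ℓ) 0ℓ
conv A = ∃[ k ] Σ (Fin k → ℕ → Q01) (λ s →
           (∀ i → Converges (s i)) ×
           (∀ a → A a → ∃[ i ] ∃[ j ] (proj₁ (s i j) ≡ proj₁ a)))

-- Katětov order  conv ≤_K S_ω.  Ω is represented by codes of clopen sets,
-- so a function on Ω is a function on codes that respects equality ≈C of
-- the clopen sets they denote.

_≤K_ : Pred (Pred Q01 0ℓ) 0ℓ → Pred (Pred Ω 0ℓ) 0ℓ → Set₁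
I ≤K J = Σ (Ω → Q01) (λ f →
           (∀ U V → proj₁ U ≈C proj₁ V → proj₁ (f U) ≡ proj₁ (f V)) ×
           (∀ (A : Pred Q01 0ℓ) → I A → J (λ U → A (f U))))

module Submission where

-- Send U ∈ Ω to the ternary value of its canonical point: the first finite string, in order of
-- length, whose padding by false lies in U. With digits 0 and 2 this value determines the point,
-- and close values force long common prefixes. Let A be covered by k convergent sequences and
-- n be given. Choose ε < 3^-(n+k+1): the points whose values lie in the ε-Cauchy tail of one
-- sequence share their first n+k+1 bits, and each of the d remaining terms is the value of at
-- most one point. So the canonical points of all U with value in A lie in k cylinders of level
-- n+k+1 and d cylinders of level n+k+1+d, of total measure at most 2^-n. Enlarged to some
-- V ∈ Ω_n, this cover meets every such U, so the preimage of A is not in S⁺_n. The cylinders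
-- exist only under double negation (whether a tail is hit at all is undecidable), which
-- suffices as S_ω is a negation.

open import Defs

import Data.Integer as ℤ
open import Data.Bool using (Bool; true; false; _∨_)
open import Data.List using (List; []; _∷_; [_]; _++_; map; drop; length; findᵇ)
open import Data.List.Membership.Propositional using (_∈_)
open import Data.List.Relation.Unary.Any using (here; there)
open import Data.Nat as ℕ using (ℕ; zero; suc; _^_)
open import Data.Nat.Properties using (m^n≢0)
open import Data.Product using (∃; ∃-syntax; _×_; _,_; proj₁; proj₂)
open import Data.Rational as ℚ using (0ℚ)
open import Data.Rational.Properties using (0/n≡0)
open import Data.Vec using (Vec; []; _∷_; toList)
open import Function using (_∘_)
open import Relation.Binary.PropositionalEquality hiding ([_])
open import Relation.Nullary using (¬_; contradiction)

module Counting where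
  open import Algebra.Properties.CommutativeSemigroup using (interchange)
  open import Data.Empty using (⊥-elim)
  open import Data.Integer.Properties using (pos-*)
  open import Data.Nat as ℕ using (z≤n; s≤s; _+_; _*_; _∸_)
  open import Data.Nat.Properties
  open import Data.Rational.Properties using (fromℚᵘ-cong)
  open import Data.Rational.Unnormalised using (mkℚᵘ; *≡*)
  open import Relation.Nullary using (yes; no)

  count-false : ∀ L → count L (λ _ → false) ≡ 0
  count-false zero    = refl
  count-false (suc L) = cong₂ _+_ (count-false L) (count-false L)

  count-true : ∀ L → count L (λ _ → true) ≡ 2 ^ L
  count-true zero    = refl
  count-true (suc L) = cong₂ _+_ (count-true L) (trans (count-true L) (sym (+-identityʳ _)))

  count≤2^ : ∀ L (c : Vec Bool L → Bool) → count L c ℕ.≤ 2 ^ L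
  count≤2^ zero c with c []
  ... | true  = ≤-refl
  ... | false = z≤n
  count≤2^ (suc L) c =
    +-mono-≤ (count≤2^ L _) (≤-trans (count≤2^ L _) (≤-reflexive (sym (+-identityʳ _))))

  count-∨ : ∀ L (c d : Vec Bool L → Bool) → count L (λ v → c v ∨ d v) ℕ.≤ count L c + count L d
  count-∨ zero c d with c [] | d []
  ... | true  | _     = s≤s z≤n
  ... | false | true  = ≤-refl
  ... | false | false = z≤n
  count-∨ (suc L) c d = begin
    count L (λ v → c (false ∷ v) ∨ d (false ∷ v)) + count L (λ v → c (true ∷ v) ∨ d (true ∷ v))
      ≤⟨ +-mono-≤ (count-∨ L _ _) (count-∨ L _ _) ⟩
    (c₀ + d₀) + (c₁ + d₁) ≡⟨ interchange +-commutativeSemigroup c₀ d₀ c₁ d₁ ⟩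
    (c₀ + c₁) + (d₀ + d₁) ∎
    where
    open ≤-Reasoning
    c₀ c₁ d₀ d₁ : ℕ
    c₀ = count L (λ v → c (false ∷ v))
    c₁ = count L (λ v → c (true ∷ v))
    d₀ = count L (λ v → d (false ∷ v))
    d₁ = count L (λ v → d (true ∷ v))

  count≢0⇒accepts : ∀ L (c : Vec Bool L → Bool) → count L c ≢ 0 → ∃[ v ] c v ≡ true
  count≢0⇒accepts zero c count≢0 with c [] in accepted
  ... | true  = [] , accepted
  ... | false = ⊥-elim (count≢0 refl)
  count≢0⇒accepts (suc L) c count≢0 with count L (λ v → c (false ∷ v)) ℕ.≟ 0
  ... | no  left≢0 = let v , cv = count≢0⇒accepts L _ left≢0 in false ∷ v , cv
  ... | yes left≡0 =
    let v , cv = count≢0⇒accepts L _ (λ right≡0 → count≢0 (cong₂ _+_ left≡0 right≡0)) in true ∷ v , cv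

  split-between : ∀ {a b t B} → a ℕ.≤ B → b ℕ.≤ B → a + b ℕ.≤ t → t ℕ.≤ B + B →
    ∃[ t₀ ] ∃[ t₁ ] (a ℕ.≤ t₀ × t₀ ℕ.≤ B) × (b ℕ.≤ t₁ × t₁ ℕ.≤ B) × t₀ + t₁ ≡ t
  split-between {a} {b} {t} {B} a≤B b≤B a+b≤t t≤2B with t ∸ b ℕ.≤? B
  ... | yes t∸b≤B =
    t ∸ b , b , (m+n≤o⇒m≤o∸n a a+b≤t , t∸b≤B) , (≤-refl , b≤B) , m∸n+n≡m (m+n≤o⇒n≤o a a+b≤t)
  ... | no  t∸b≰B = B , t ∸ B , (a≤B , ≤-refl) , (b≤t∸B , t∸B≤B) , m+[n∸m]≡n B≤t
    where
    B+b≤t : B + b ℕ.≤ t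
    B+b≤t = ≤-trans (+-monoˡ-≤ b (<⇒≤ (≰⇒> t∸b≰B))) (≤-reflexive (m∸n+n≡m (m+n≤o⇒n≤o a a+b≤t)))
    B≤t : B ℕ.≤ t
    B≤t = m+n≤o⇒m≤o B B+b≤t
    b≤t∸B : b ℕ.≤ t ∸ B
    b≤t∸B = m+n≤o⇒m≤o∸n b (≤-trans (≤-reflexive (+-comm b B)) B+b≤t)
    t∸B≤B : t ∸ B ℕ.≤ B
    t∸B≤B = ≤-trans (∸-monoˡ-≤ B t≤2B) (≤-reflexive (m+n∸m≡n B B))

  count-extend : ∀ L (c : Vec Bool L → Bool) t → count L c ℕ.≤ t → t ℕ.≤ 2 ^ L →
    ∃[ c′ ] (∀ v → c v ≡ true → c′ v ≡ true) × count L c′ ≡ t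
  count-extend zero c zero          c≤t _ = c , (λ _ cv → cv) , ≤-antisym c≤t z≤n
  count-extend zero c (suc zero)    _   _ = (λ _ → true) , (λ _ _ → refl) , refl
  count-extend zero c (suc (suc t)) _   (s≤s ())
  count-extend (suc L) c t c≤t t≤2^L
    with split-between (count≤2^ L (λ v → c (false ∷ v))) (count≤2^ L (λ v → c (true ∷ v))) c≤t
           (≤-trans t≤2^L (≤-reflexive (cong (2 ^ L +_) (+-identityʳ (2 ^ L)))))
  ... | t₀ , t₁ , (c₀≤t₀ , t₀≤) , (c₁≤t₁ , t₁≤) , t₀+t₁≡t
    with count-extend L _ t₀ c₀≤t₀ t₀≤ | count-extend L _ t₁ c₁≤t₁ t₁≤
  ... | c₀′ , c₀⊆ , count₀ | c₁′ , c₁⊆ , count₁ = c′ , c⊆c′ , trans (cong₂ _+_ count₀ count₁) t₀+t₁≡t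
    where
    c′ : Vec Bool (suc L) → Bool
    c′ (false ∷ v) = c₀′ v
    c′ (true  ∷ v) = c₁′ v
    c⊆c′ : ∀ v → c v ≡ true → c′ v ≡ true
    c⊆c′ (false ∷ v) = c₀⊆ v
    c⊆c′ (true  ∷ v) = c₁⊆ v

  /-cross : ∀ a b c d .{{_ : ℕ.NonZero b}} .{{_ : ℕ.NonZero d}} →
    a * d ≡ c * b → ℤ.+ a ℚ./ b ≡ ℤ.+ c ℚ./ d
  /-cross a (suc b) c (suc d) ad≡cb = fromℚᵘ-cong {mkℚᵘ (ℤ.+ a) b} {mkℚᵘ (ℤ.+ c) d}
    (*≡* (trans (sym (pos-* a (suc d))) (trans (cong ℤ.+_ ad≡cb) (pos-* c (suc b)))))

  μ-count≡2^ : ∀ n s (c : Vec Bool (n + s) → Bool) → count (n + s) c ≡ 2 ^ s →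
    μ (clopen (n + s) c) ≡ half^ n
  μ-count≡2^ n s c count≡ = /-cross (count (n + s) c) (2 ^ (n + s)) 1 (2 ^ n)
    {{m^n≢0 2 (n + s)}} {{m^n≢0 2 n}} (begin
    count (n + s) c * 2 ^ n ≡⟨ cong (_* 2 ^ n) count≡ ⟩
    2 ^ s * 2 ^ n           ≡⟨ sym (^-distribˡ-+-* 2 s n) ⟩
    2 ^ (s + n)             ≡⟨ cong (2 ^_) (+-comm s n) ⟩
    2 ^ (n + s)             ≡⟨ sym (*-identityˡ _) ⟩
    1 * 2 ^ (n + s)         ∎)
    where open ≡-Reasoning

  count≤⇒⊆Ωₙ : ∀ n s (c : Vec Bool (n + s) → Bool) → count (n + s) c ℕ.≤ 2 ^ s →
    ∃[ V ] Ωₙ n V × (∀ x → c (take (n + s) x) ≡ true → x ∈C V)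
  count≤⇒⊆Ωₙ n s c count≤ with count-extend (n + s) c (2 ^ s) count≤ (^-monoʳ-≤ 2 (m≤n+m s n))
  ... | c′ , c⊆c′ , count≡ =
    clopen (n + s) c′ , μ-count≡2^ n s c′ count≡ , λ x → c⊆c′ (take (n + s) x)

module Cylinders where
  open import Data.Bool.ListAction using (any)
  open import Data.Bool.Properties using (∨-zeroʳ)
  open import Data.Nat as ℕ using (z≤n; s≤s; _*_; _∸_)
  open import Data.Nat.Properties
  open Counting using (count-false; count-true; count-∨)

  prefixᵇ : ∀ {m L} → Vec Bool m → Vec Bool L → Bool
  prefixᵇ []          _           = true
  prefixᵇ (_ ∷ _)     []          = false
  prefixᵇ (false ∷ u) (false ∷ v) = prefixᵇ u v
  prefixᵇ (true  ∷ u) (true  ∷ v) = prefixᵇ u v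
  prefixᵇ (_ ∷ _)     (_ ∷ _)     = false

  count-prefixᵇ : ∀ L {m} (u : Vec Bool m) → count L (prefixᵇ u) ℕ.≤ 2 ^ (L ∸ m)
  count-prefixᵇ L       []          = ≤-reflexive (count-true L)
  count-prefixᵇ zero    (_ ∷ _)     = z≤n
  count-prefixᵇ (suc L) (false ∷ u) =
    ≤-trans (+-monoʳ-≤ (count L (prefixᵇ u)) (≤-reflexive (count-false L)))
            (≤-trans (≤-reflexive (+-identityʳ _)) (count-prefixᵇ L u))
  count-prefixᵇ (suc L) (true  ∷ u) =
    ≤-trans (+-monoˡ-≤ (count L (prefixᵇ u)) (≤-reflexive (count-false L))) (count-prefixᵇ L u)

  prefixᵇ-take : ∀ m L (x : Cantor) → m ℕ.≤ L → prefixᵇ (take m x) (take L x) ≡ true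
  prefixᵇ-take zero    L       x _         = refl
  prefixᵇ-take (suc m) (suc L) x (s≤s m≤L) with x 0
  ... | false = prefixᵇ-take m L (λ i → x (suc i)) m≤L
  ... | true  = prefixᵇ-take m L (λ i → x (suc i)) m≤L

  inCylinders : ∀ {m L} → List (Vec Bool m) → Vec Bool L → Bool
  inCylinders us v = any (λ u → prefixᵇ u v) us

  count-inCylinders : ∀ L {m} (us : List (Vec Bool m)) →
    count L (inCylinders us) ℕ.≤ length us * 2 ^ (L ∸ m)
  count-inCylinders L []       = ≤-reflexive (count-false L)
  count-inCylinders L (u ∷ us) = ≤-trans (count-∨ L (prefixᵇ u) (inCylinders us))
    (+-mono-≤ (count-prefixᵇ L u) (count-inCylinders L us))

  take∈⇒inCylinders : ∀ {m L} (x : Cantor) {us : List (Vec Bool m)} → m ℕ.≤ L →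
    take m x ∈ us → inCylinders us (take L x) ≡ true
  take∈⇒inCylinders {m} {L} x m≤L (here refl) rewrite prefixᵇ-take m L x m≤L = refl
  take∈⇒inCylinders {L = L} x {u ∷ _} m≤L (there ∈us)
    rewrite take∈⇒inCylinders x m≤L ∈us = ∨-zeroʳ (prefixᵇ u (take L x))

module CanonicalString where
  open import Data.List.Properties using (++-identityʳ; ++-assoc)
  open import Data.List.Membership.Propositional.Properties using (∈-++⁺ˡ; ∈-++⁺ʳ; ∈-map⁺)
  open import Data.Maybe using (just; nothing; fromMaybe)
  open import Data.Nat as ℕ using (_+_; _∸_)
  open import Data.Nat.Properties using (m∸n+n≡m; m≤m⊔n; m≤n⊔m)
  open Counting using (count≢0⇒accepts)

  headᶠ : List Bool → Bool
  headᶠ []      = false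
  headᶠ (b ∷ _) = b

  pad : List Bool → Cantor
  pad w zero    = headᶠ w
  pad w (suc i) = pad (drop 1 w) i

  take-pad : ∀ {L} (v : Vec Bool L) → take L (pad (toList v)) ≡ v
  take-pad []      = refl
  take-pad (b ∷ v) = cong (b ∷_) (take-pad v)

  strings : ℕ → List (List Bool)
  strings zero    = [ [] ]
  strings (suc l) = map (false ∷_) (strings l) ++ map (true ∷_) (strings l)

  toList∈strings : ∀ {l} (v : Vec Bool l) → toList v ∈ strings l
  toList∈strings []                = here refl
  toList∈strings {suc l} (false ∷ v) = ∈-++⁺ˡ (∈-map⁺ (false ∷_) (toList∈strings v))
  toList∈strings {suc l} (true  ∷ v) =
    ∈-++⁺ʳ (map (false ∷_) (strings l)) (∈-map⁺ (true ∷_) (toList∈strings v))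

  stringsUpTo : ℕ → List (List Bool)
  stringsUpTo zero    = strings zero
  stringsUpTo (suc B) = stringsUpTo B ++ strings (suc B)

  strings⊆stringsUpTo : ∀ B {w} → w ∈ strings B → w ∈ stringsUpTo B
  strings⊆stringsUpTo zero    w∈ = w∈
  strings⊆stringsUpTo (suc B) w∈ = ∈-++⁺ʳ (stringsUpTo B) w∈

  stringsUpTo-+ : ∀ k B → ∃[ ys ] stringsUpTo (k + B) ≡ stringsUpTo B ++ ys
  stringsUpTo-+ zero    B = [] , sym (++-identityʳ _)
  stringsUpTo-+ (suc k) B with stringsUpTo-+ k B
  ... | ys , eq = ys ++ strings (suc (k + B)) ,
    trans (cong (_++ strings (suc (k + B))) eq) (++-assoc (stringsUpTo B) ys _)

  stringsUpTo-mono : ∀ {B B′} → B ℕ.≤ B′ → ∃[ ys ] stringsUpTo B′ ≡ stringsUpTo B ++ ys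
  stringsUpTo-mono {B} {B′} B≤B′ =
    subst (λ C → ∃[ ys ] stringsUpTo C ≡ stringsUpTo B ++ ys) (m∸n+n≡m B≤B′)
          (stringsUpTo-+ (B′ ∸ B) B)

  module _ {A : Set} where

    findᵇ-sound : ∀ (p : A → Bool) xs {x} → findᵇ p xs ≡ just x → p x ≡ true
    findᵇ-sound p (y ∷ xs) found with p y in py
    findᵇ-sound p (y ∷ xs) refl  | true  = py
    ...                          | false = findᵇ-sound p xs found

    findᵇ-complete : ∀ (p : A → Bool) {xs x} → x ∈ xs → p x ≡ true → ∃[ y ] findᵇ p xs ≡ just y
    findᵇ-complete p {y ∷ xs} x∈ px with p y in py
    ... | true = y , refl
    findᵇ-complete p {y ∷ xs} (here refl) px | false = contradiction (trans (sym py) px) λ ()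
    findᵇ-complete p {y ∷ xs} (there x∈) px  | false = findᵇ-complete p x∈ px

    findᵇ-none : ∀ (p : A → Bool) xs → (∀ {y} → y ∈ xs → p y ≢ true) → findᵇ p xs ≡ nothing
    findᵇ-none p []       _    = refl
    findᵇ-none p (y ∷ xs) none with p y in py
    ... | true  = contradiction py (none (here refl))
    ... | false = findᵇ-none p xs (λ y∈ → none (there y∈))

    findᵇ-++ : ∀ (p : A → Bool) xs ys →
      (∀ {y} → y ∈ ys → p y ≡ true → ∃[ x ] x ∈ xs × p x ≡ true) →
      findᵇ p (xs ++ ys) ≡ findᵇ p xs
    findᵇ-++ p []       ys witness = findᵇ-none p ys (λ y∈ py → ∉[] (witness y∈ py))
      where ∉[] : ¬ (∃[ x ] x ∈ [] × p x ≡ true)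
            ∉[] (_ , () , _)
    findᵇ-++ p (x ∷ xs) ys witness with p x in px
    ... | true  = refl
    ... | false = findᵇ-++ p xs ys (λ y∈ py → drop-head (witness y∈ py))
      where
      drop-head : (∃[ z ] z ∈ x ∷ xs × p z ≡ true) → ∃[ z ] z ∈ xs × p z ≡ true
      drop-head (_ , here refl , pz) = contradiction (trans (sym px) pz) λ ()
      drop-head (z , there z∈ , pz)  = z , z∈ , pz

    findᵇ-cong : ∀ {p q : A → Bool} → (∀ x → p x ≡ q x) → ∀ xs → findᵇ p xs ≡ findᵇ q xs
    findᵇ-cong p≗q []       = refl
    findᵇ-cong {p} {q} p≗q (x ∷ xs) with p x | q x | p≗q x
    ... | true  | .true  | refl = refl
    ... | false | .false | refl = findᵇ-cong p≗q xs

  memᵇ : Clopen → List Bool → Bool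
  memᵇ U w = chars U (take (level U) (pad w))

  memᵇ-toList : ∀ U (v : Vec Bool (level U)) → memᵇ U (toList v) ≡ chars U v
  memᵇ-toList U v = cong (chars U) (take-pad v)

  memᵇ-witness : ∀ U {w} → memᵇ U w ≡ true →
    ∃[ x ] x ∈ stringsUpTo (level U) × memᵇ U x ≡ true
  memᵇ-witness U {w} w∈U = toList v , strings⊆stringsUpTo (level U) (toList∈strings v) ,
    trans (memᵇ-toList U v) w∈U
    where
    v : Vec Bool (level U)
    v = take (level U) (pad w)

  findᵇ-memᵇ-stable : ∀ U {B} → level U ℕ.≤ B →
    findᵇ (memᵇ U) (stringsUpTo B) ≡ findᵇ (memᵇ U) (stringsUpTo (level U))
  findᵇ-memᵇ-stable U level≤B with stringsUpTo-mono level≤B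
  ... | ys , extends rewrite extends = findᵇ-++ (memᵇ U) _ ys (λ _ → memᵇ-witness U)

  -- [] is a junk value, taken only when U is empty.
  canonical : Clopen → List Bool
  canonical U = fromMaybe [] (findᵇ (memᵇ U) (stringsUpTo (level U)))

  canonical-cong : ∀ U V → U ≈C V → canonical U ≡ canonical V
  canonical-cong U V U≈V = cong (fromMaybe []) (begin
    findᵇ (memᵇ U) (stringsUpTo (level U)) ≡⟨ sym (findᵇ-memᵇ-stable U (m≤m⊔n (level U) (level V))) ⟩
    findᵇ (memᵇ U) (stringsUpTo B)         ≡⟨ findᵇ-cong (λ w → U≈V (pad w)) (stringsUpTo B) ⟩
    findᵇ (memᵇ V) (stringsUpTo B)         ≡⟨ findᵇ-memᵇ-stable V (m≤n⊔m (level U) (level V)) ⟩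
    findᵇ (memᵇ V) (stringsUpTo (level V)) ∎)
    where
    open ≡-Reasoning
    B : ℕ
    B = level U ℕ.⊔ level V

  canonical-∈ : ∀ U → count (level U) (chars U) ≢ 0 → pad (canonical U) ∈C U
  canonical-∈ U count≢0 with count≢0⇒accepts (level U) (chars U) count≢0
  ... | v , v∈U with findᵇ-complete (memᵇ U) (strings⊆stringsUpTo (level U) (toList∈strings v))
                                            (trans (memᵇ-toList U v) v∈U)
  ... | y , found rewrite found = findᵇ-sound (memᵇ U) (stringsUpTo (level U)) found

module TernaryEmbedding where
  open import Data.Integer as ℤ using (+≤+; +<+)
  open import Data.Nat using (z≤n; s≤s)
  open import Data.Rational
  open import Data.Rational.Properties
  import Data.Rational.Solver as Solver
  open import Data.Bool.Properties using () renaming (_≟_ to _≟ᵇ_)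
  open import Relation.Nullary using (yes; no)
  open CanonicalString using (headᶠ; pad)

  ⅓ : ℚ
  ⅓ = ℤ.+ 1 / 3

  digit : Bool → ℚ
  digit false = 0ℚ
  digit true  = ℤ.+ 2 / 1

  -- Digits 0 and 2, as for the middle-thirds Cantor set, keep strings whose first bits differ
  -- at least 1/3 apart.
  ternary : List Bool → ℚ
  ternary []      = 0ℚ
  ternary (b ∷ w) = (digit b + ternary w) * ⅓

  ternary-unfold : ∀ w → ternary w ≡ (digit (headᶠ w) + ternary (drop 1 w)) * ⅓
  ternary-unfold []      = refl
  ternary-unfold (_ ∷ _) = refl

  0≤digit : ∀ b → 0ℚ ≤ digit b
  0≤digit false = ≤-refl
  0≤digit true  = *≤* (+≤+ z≤n)

  digit≤2 : ∀ b → digit b ≤ ℤ.+ 2 / 1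
  digit≤2 false = *≤* (+≤+ z≤n)
  digit≤2 true  = ≤-refl

  0≤ternary : ∀ w → 0ℚ ≤ ternary w
  0≤ternary []      = ≤-refl
  0≤ternary (b ∷ w) = *-monoʳ-≤-nonNeg ⅓ (+-mono-≤ (0≤digit b) (0≤ternary w))

  ternary≤1 : ∀ w → ternary w ≤ 1ℚ
  ternary≤1 []      = *≤* (+≤+ z≤n)
  ternary≤1 (b ∷ w) = *-monoʳ-≤-nonNeg ⅓ (+-mono-≤ (digit≤2 b) (ternary≤1 w))

  ⅓^ : ℕ → ℚ
  ⅓^ zero    = 1ℚ
  ⅓^ (suc m) = ⅓^ m * ⅓

  ⅓^-positive : ∀ m → Positive (⅓^ m)
  ⅓^-positive zero    = _
  ⅓^-positive (suc m) = pos*pos⇒pos (⅓^ m) {{⅓^-positive m}} ⅓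

  ⅓^≤1 : ∀ m → ⅓^ m ≤ 1ℚ
  ⅓^≤1 zero    = ≤-refl
  ⅓^≤1 (suc m) = ≤-trans (*-monoʳ-≤-nonNeg ⅓ (⅓^≤1 m)) (*≤* (+≤+ (s≤s z≤n)))

  ⅓^-suc< : ∀ m → ⅓^ (suc m) < ⅓^ m
  ⅓^-suc< m = <-≤-trans (*-monoʳ-<-pos (⅓^ m) {{⅓^-positive m}} (*<* (+<+ (s≤s (s≤s z≤n)))))
                         (≤-reflexive (*-identityʳ (⅓^ m)))

  open Solver.+-*-Solver

  ∣-∣-comm : ∀ p q → ∣ p - q ∣ ≡ ∣ q - p ∣
  ∣-∣-comm p q = trans (sym (∣-p∣≡∣p∣ (p - q)))
    (cong ∣_∣ (solve 2 (λ p q → :- (p :- q) := q :- p) refl p q))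

  ternary-gap : ∀ w w′ → headᶠ w ≡ true → headᶠ w′ ≡ false → ⅓ ≤ ∣ ternary w - ternary w′ ∣
  ternary-gap w w′ hw hw′ = subst (⅓ ≤_) (sym (0≤p⇒∣p∣≡p (≤-trans (nonNegative⁻¹ ⅓) gap))) gap
    where
    two a b : ℚ
    two = ℤ.+ 2 / 1
    a = ternary (drop 1 w)
    b = ternary (drop 1 w′)
    unfold : ∀ v {c} → headᶠ v ≡ c → ternary v ≡ (digit c + ternary (drop 1 v)) * ⅓
    unfold v refl = ternary-unfold v
    gap : ⅓ ≤ ternary w - ternary w′
    gap = begin
      ⅓                             ≡⟨ sym (*-identityˡ ⅓) ⟩
      1ℚ * ⅓                        ≤⟨ *-monoʳ-≤-nonNeg ⅓ 1≤two+a-b ⟩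
      (two + a - b) * ⅓             ≡⟨ solve 4 (λ two a b t → (two :+ a :- b) :* t
                                         := (two :+ a) :* t :- (con 0ℚ :+ b) :* t) refl two a b ⅓ ⟩
      (two + a) * ⅓ - (0ℚ + b) * ⅓  ≡⟨ sym (cong₂ _-_ (unfold w hw) (unfold w′ hw′)) ⟩
      ternary w - ternary w′        ∎
      where
      open ≤-Reasoning
      1≤two+a-b : 1ℚ ≤ two + a - b
      1≤two+a-b = +-mono-≤ (+-monoʳ-≤ two (0≤ternary (drop 1 w)))
                           (neg-antimono-≤ (ternary≤1 (drop 1 w′)))

  ⅓≤∣ternary-ternary∣ : ∀ w w′ → headᶠ w ≢ headᶠ w′ → ⅓ ≤ ∣ ternary w - ternary w′ ∣
  ⅓≤∣ternary-ternary∣ w w′ heads≢ with headᶠ w in hw | headᶠ w′ in hw′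
  ... | true  | true  = contradiction refl heads≢
  ... | false | false = contradiction refl heads≢
  ... | true  | false = ternary-gap w w′ hw hw′
  ... | false | true  = subst (⅓ ≤_) (∣-∣-comm (ternary w′) (ternary w)) (ternary-gap w′ w hw′ hw)

  ternary-same-head : ∀ w w′ → headᶠ w ≡ headᶠ w′ →
    ∣ ternary w - ternary w′ ∣ ≡ ∣ ternary (drop 1 w) - ternary (drop 1 w′) ∣ * ⅓
  ternary-same-head w w′ heads≡ = begin
    ∣ ternary w - ternary w′ ∣ ≡⟨ cong₂ (λ x y → ∣ x - y ∣) (ternary-unfold w) (ternary-unfold w′) ⟩
    ∣ (digit (headᶠ w) + a) * ⅓ - (digit (headᶠ w′) + b) * ⅓ ∣
      ≡⟨ cong (λ c → ∣ (digit (headᶠ w) + a) * ⅓ - (digit c + b) * ⅓ ∣) (sym heads≡) ⟩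
    ∣ (digit (headᶠ w) + a) * ⅓ - (digit (headᶠ w) + b) * ⅓ ∣
      ≡⟨ cong ∣_∣ (solve 4 (λ d a b t → (d :+ a) :* t :- (d :+ b) :* t := (a :- b) :* t)
                          refl (digit (headᶠ w)) a b ⅓) ⟩
    ∣ (a - b) * ⅓ ∣            ≡⟨ ∣p*q∣≡∣p∣*∣q∣ (a - b) ⅓ ⟩
    ∣ a - b ∣ * ⅓              ∎
    where
    open ≡-Reasoning
    a b : ℚ
    a = ternary (drop 1 w)
    b = ternary (drop 1 w′)

  ternary-close⇒take≡ : ∀ m w w′ → ∣ ternary w - ternary w′ ∣ < ⅓^ m →
    take m (pad w) ≡ take m (pad w′)
  ternary-close⇒take≡ zero    w w′ _     = refl
  ternary-close⇒take≡ (suc m) w w′ close with headᶠ w ≟ᵇ headᶠ w′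
  ... | no  heads≢ = contradiction (begin-strict
    ⅓                           ≤⟨ ⅓≤∣ternary-ternary∣ w w′ heads≢ ⟩
    ∣ ternary w - ternary w′ ∣  <⟨ close ⟩
    ⅓^ m * ⅓                    ≤⟨ *-monoʳ-≤-nonNeg ⅓ (⅓^≤1 m) ⟩
    1ℚ * ⅓                      ≡⟨ *-identityˡ ⅓ ⟩
    ⅓                           ∎) (<-irrefl refl)
    where open ≤-Reasoning
  ... | yes heads≡ = cong₂ _∷_ heads≡ (ternary-close⇒take≡ m (drop 1 w) (drop 1 w′)
    (*-cancelʳ-<-nonNeg ⅓ (subst (_< ⅓^ m * ⅓) (ternary-same-head w w′ heads≡) close)))

  ternary-injective-take : ∀ m w w′ → ternary w ≡ ternary w′ → take m (pad w) ≡ take m (pad w′)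
  ternary-injective-take m w w′ same = ternary-close⇒take≡ m w w′
    (subst (λ x → ∣ ternary w - x ∣ < ⅓^ m) same
      (subst (_< ⅓^ m) (sym (cong ∣_∣ (+-inverseʳ (ternary w))))
        (positive⁻¹ (⅓^ m) {{⅓^-positive m}})))

module Covering where
  open import Data.Empty using (⊥-elim)
  open import Data.List.Relation.Unary.Any using (Any)
  open import Data.List.Properties using (length-++)
  open import Data.List.Membership.Propositional.Properties using (∈-++⁺ˡ; ∈-++⁺ʳ)
  open import Data.Nat using (_≤_; z≤n)
  open import Data.Nat.Properties using (≤-refl; ≤-trans; ≤-reflexive; +-mono-≤)
  open import Data.Rational using (ℚ)
  open import Effect.Monad using (RawMonad)
  open import Level using (0ℓ)
  open import Relation.Nullary using (Dec; yes; no)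
  open import Relation.Nullary.Negation using (DoubleNegation; ¬¬-Monad)
  open import Relation.Nullary.Decidable using (¬¬-excluded-middle)
  open import Relation.Unary using (Pred)
  open RawMonad (¬¬-Monad {0ℓ})
  open CanonicalString using (pad)
  open TernaryEmbedding using (ternary)

  PrefixDetermined : ℕ → Pred ℚ 0ℓ → Set
  PrefixDetermined m S = ∀ w w′ → S (ternary w) → S (ternary w′) → take m (pad w) ≡ take m (pad w′)

  CoveredBy : ∀ m → List (Vec Bool m) → Pred ℚ 0ℓ → Set
  CoveredBy m us S = ∀ w → S (ternary w) → take m (pad w) ∈ us

  prefixDetermined⇒coverable : ∀ {m S} → PrefixDetermined m S →
    DoubleNegation (∃[ us ] length us ≤ 1 × CoveredBy m us S)
  prefixDetermined⇒coverable {m} {S} determined = do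
    hit? ← ¬¬-excluded-middle
    pure (cover hit?)
    where
    cover : Dec (∃[ w ] S (ternary w)) → ∃[ us ] length us ≤ 1 × CoveredBy m us S
    cover (yes (w , Sw)) = [ take m (pad w) ] , ≤-refl , λ w′ Sw′ → here (determined w′ w Sw′ Sw)
    cover (no  miss)     = [] , z≤n , λ w′ Sw′ → ⊥-elim (miss (w′ , Sw′))

  coverable-⋃ : ∀ {m} {I : Set} (S : I → Pred ℚ 0ℓ) (is : List I) →
    (∀ i → PrefixDetermined m (S i)) →
    DoubleNegation (∃[ us ] length us ≤ length is × CoveredBy m us (λ q → Any (λ i → S i q) is))
  coverable-⋃ S []       _          = pure ([] , z≤n , λ _ ())
  coverable-⋃ S (i ∷ is) determined = do
    us₁ , len₁ , cov₁ ← prefixDetermined⇒coverable {S = S i} (determined i)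
    us₂ , len₂ , cov₂ ← coverable-⋃ S is determined
    pure (us₁ ++ us₂ , ≤-trans (≤-reflexive (length-++ us₁)) (+-mono-≤ len₁ len₂) , λ where
      w (here  Sw) → ∈-++⁺ˡ (cov₁ w Sw)
      w (there Sw) → ∈-++⁺ʳ us₁ (cov₂ w Sw))

module ConvergentTerms where
  open import Data.Bool.Properties using (∨-zeroʳ)
  open import Data.Fin using (Fin)
  open import Data.List using (concatMap; upTo; allFin)
  open import Data.List.Membership.Propositional using (lose)
  open import Data.List.Membership.Propositional.Properties
    using (∈-concatMap⁺; ∈-map⁺; ∈-upTo⁺; ∈-allFin)
  open import Data.List.Properties using (length-tabulate)
  open import Data.List.Relation.Unary.Any using (Any)
  open import Data.Nat as ℕ using (_+_; _*_; _∸_; z≤n)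
  open import Data.Nat.Properties
  import Data.Rational.Properties as ℚ
  open import Effect.Monad using (RawMonad)
  open import Function using (id)
  open import Level using (0ℓ)
  open import Relation.Nullary using (yes; no)
  open import Relation.Nullary.Negation using (DoubleNegation; ¬¬-Monad)
  open import Relation.Unary using (Pred)
  open RawMonad (¬¬-Monad {0ℓ})
  open Counting
  open Cylinders
  open CanonicalString using (pad)
  open TernaryEmbedding
  open Covering

  n≤2^n : ∀ n → n ℕ.≤ 2 ^ n
  n≤2^n zero    = z≤n
  n≤2^n (suc n) = +-mono-≤ (m^n>0 2 n) (≤-trans (n≤2^n n) (≤-reflexive (sym (+-identityʳ (2 ^ n)))))

  cylinder-budget : ∀ k d → k * 2 ^ d + d * 1 ℕ.≤ 2 ^ (suc k + d)
  cylinder-budget k d = begin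
    k * 2 ^ d + d * 1
      ≤⟨ +-mono-≤ (*-monoˡ-≤ (2 ^ d) (n≤2^n k)) (≤-trans (≤-reflexive (*-identityʳ d)) (n≤2^n d)) ⟩
    2 ^ k * 2 ^ d + 2 ^ d
      ≤⟨ +-monoʳ-≤ (2 ^ k * 2 ^ d) (m≤n*m (2 ^ d) (2 ^ k) {{m^n≢0 2 k}}) ⟩
    2 ^ k * 2 ^ d + 2 ^ k * 2 ^ d ≡⟨ cong (λ x → x + x) (sym (^-distribˡ-+-* 2 k d)) ⟩
    2 ^ (k + d) + 2 ^ (k + d)     ≡⟨ cong (2 ^ (k + d) +_) (sym (+-identityʳ _)) ⟩
    2 ^ (suc k + d)               ∎
    where open ≤-Reasoning

  module _ (n k : ℕ) (s : Fin k → ℕ → Q01) (converges : ∀ i → Converges (s i)) where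
    private
      term : Fin k → ℕ → ℚ.ℚ
      term i j = proj₁ (s i j)

      M : ℕ
      M = n + suc k

      ε : ℚ.ℚ
      ε = ⅓^ (suc M)

      N : Fin k → ℕ
      N i = proj₁ (converges i ε (ℚ.positive⁻¹ ε {{⅓^-positive (suc M)}}))

      Tail : Fin k → Pred ℚ.ℚ 0ℓ
      Tail i q = ∃[ j ] N i ℕ.≤ j × term i j ≡ q

      tail-determined : ∀ i → PrefixDetermined M (Tail i)
      tail-determined i w w′ (j , Ni≤j , tj≡) (j′ , Ni≤j′ , tj′≡) = ternary-close⇒take≡ M w w′
        (ℚ.≤-<-trans (subst₂ (λ a b → ℚ.∣ a ℚ.- b ∣ ℚ.≤ ε) tj≡ tj′≡
                       (proj₂ (converges i ε _) j j′ Ni≤j Ni≤j′))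
                     (⅓^-suc< M))

      heads : List (Fin k × ℕ)
      heads = concatMap (λ i → map (i ,_) (upTo (N i))) (allFin k)

      Head : Fin k × ℕ → Pred ℚ.ℚ 0ℓ
      Head (i , j) q = term i j ≡ q

      d L : ℕ
      d = length heads
      L = n + (suc k + d)

      head-determined : ∀ ij → PrefixDetermined L (Head ij)
      head-determined _ w w′ t≡ t≡′ = ternary-injective-take L w w′ (trans (sym t≡) t≡′)

      M≤L : M ℕ.≤ L
      M≤L = ≤-trans (m≤m+n M d) (≤-reflexive (+-assoc n (suc k) d))

      L∸M≡d : L ∸ M ≡ d
      L∸M≡d = trans (cong (_∸ M) (sym (+-assoc n (suc k) d))) (m+n∸m≡n M d)

      cover : List (Vec Bool M) → List (Vec Bool L) → Vec Bool L → Bool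
      cover T R v = inCylinders T v ∨ inCylinders R v

      count-cover : ∀ T R → length T ℕ.≤ length (allFin k) → length R ℕ.≤ d →
        count L (cover T R) ℕ.≤ 2 ^ (suc k + d)
      count-cover T R T≤k R≤d = begin
        count L (cover T R)
          ≤⟨ count-∨ L (inCylinders T) (inCylinders R) ⟩
        count L (inCylinders T) + count L (inCylinders R)
          ≤⟨ +-mono-≤ (count-inCylinders L T) (count-inCylinders L R) ⟩
        length T * 2 ^ (L ∸ M) + length R * 2 ^ (L ∸ L)
          ≡⟨ cong₂ (λ a b → length T * 2 ^ a + length R * 2 ^ b) L∸M≡d (n∸n≡0 L) ⟩
        length T * 2 ^ d + length R * 1
          ≤⟨ +-mono-≤ (*-monoˡ-≤ (2 ^ d) (≤-trans T≤k (≤-reflexive (length-tabulate {n = k} id))))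
                      (*-monoˡ-≤ 1 R≤d) ⟩
        k * 2 ^ d + d * 1
          ≤⟨ cylinder-budget k d ⟩
        2 ^ (suc k + d) ∎
        where open ≤-Reasoning

      term∈cover : ∀ {T R} → CoveredBy M T (λ q → Any (λ i → Tail i q) (allFin k)) →
        CoveredBy L R (λ q → Any (λ ij → Head ij q) heads) →
        ∀ w i j → ternary w ≡ term i j → cover T R (take L (pad w)) ≡ true
      term∈cover {T} {R} T-covers R-covers w i j w↦tij with j ℕ.<? N i
      ... | yes j<N = trans (cong (inCylinders T (take L (pad w)) ∨_) in-R) (∨-zeroʳ _)
        where
        ij∈heads : (i , j) ∈ heads
        ij∈heads = ∈-concatMap⁺ (λ i → map (i ,_) (upTo (N i)))
                     (lose (∈-allFin i) (∈-map⁺ (i ,_) (∈-upTo⁺ j<N)))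
        in-R : inCylinders R (take L (pad w)) ≡ true
        in-R = take∈⇒inCylinders (pad w) ≤-refl (R-covers w (lose ij∈heads (sym w↦tij)))
      ... | no  j≮N = cong (_∨ _) (take∈⇒inCylinders (pad w) M≤L
                        (T-covers w (lose (∈-allFin i) (j , ≮⇒≥ j≮N , sym w↦tij))))

    termPoints⊆Ωₙ :
      DoubleNegation (∃[ V ] Ωₙ n V × (∀ w i j → ternary w ≡ proj₁ (s i j) → pad w ∈C V))
    termPoints⊆Ωₙ = do
      T , T≤k , T-covers ← coverable-⋃ Tail (allFin k) tail-determined
      R , R≤d , R-covers ← coverable-⋃ Head heads head-determined
      let V , V∈Ωₙ , cover⊆V = count≤⇒⊆Ωₙ n (suc k + d) (cover T R) (count-cover T R T≤k R≤d)
      pure (V , V∈Ωₙ , λ w i j w↦tij → cover⊆V (pad w) (term∈cover T-covers R-covers w i j w↦tij))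

open CanonicalString using (pad; canonical; canonical-cong; canonical-∈)
open TernaryEmbedding using (ternary; 0≤ternary; ternary≤1)
open ConvergentTerms using (termPoints⊆Ωₙ)

Ω⇒count≢0 : ∀ (U : Ω) → count (level (proj₁ U)) (chars (proj₁ U)) ≢ 0
Ω⇒count≢0 (U , μU≡½) count≡0 = 0≢½ (trans (sym μU≡0) μU≡½)
  where
  instance
    2^level≢0 : ℕ.NonZero (2 ^ level U)
    2^level≢0 = m^n≢0 2 (level U)
  μU≡0 : μ U ≡ 0ℚ
  μU≡0 = trans (cong (λ c → ℤ.+ c ℚ./ 2 ^ level U) count≡0) (0/n≡0 (2 ^ level U))
  0≢½ : 0ℚ ≢ half^ 1
  0≢½ ()

canonicalValue : Ω → Q01
canonicalValue (U , _) = ternary (canonical U) , 0≤ternary (canonical U) , ternary≤1 (canonical U)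

proposition3p8 : conv ≤K Sω
proposition3p8 = canonicalValue , respects-≈C , preimage∈Sω
  where
  respects-≈C : ∀ U V → proj₁ U ≈C proj₁ V → proj₁ (canonicalValue U) ≡ proj₁ (canonicalValue V)
  respects-≈C U V = cong ternary ∘ canonical-cong (proj₁ U) (proj₁ V)

  preimage∈Sω : ∀ A → conv A → Sω (λ U → A (canonicalValue U))
  preimage∈Sω A (k , s , converges , covered) (n , large) =
    termPoints⊆Ωₙ n k s converges λ (V , V∈Ωₙ , terms⊆V) →
      let (U , U∈Ω) , AfU , U∩V≡∅ = large V V∈Ωₙ
          i , j , sij≡fU = covered (canonicalValue (U , U∈Ω)) AfU
      in U∩V≡∅ (pad (canonical U)) (canonical-∈ U (Ω⇒count≢0 (U , U∈Ω)) , terms⊆V _ i j (sym sij≡fU))
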